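{- If $M$ is a PG-sum, then $\chi(M)=\omega(M)$.
   Context: A matroid is a pair $M=(E,G)$ where $G$ is the set of nonzero vectors of a finite-dimensional $\mathbb F_2$-vector space $V(G)=G\cup\{0\}$ and $E\subseteq G$; $\dim(M)=\dim V(G)$. A flat of $G$ is a set $F\subseteq G$ with $F\cup\{0\}$ a subspace, of dimension that of the subspace. $M$ is a PG-sum if $E$ is the disjoint union of two (possibly empty) flats of $G$. $\omega(M)$ is the largest dimension of a flat contained in $E$; $M^c=(G\setminus E,G)$; $\chi(M)=\dim(M)-\omega(M^c)$. -}

module Defs where

open import Data.Bool using (Bool; true; false; _xor_; _∧_)
open import Data.Nat using (ℕ; _≤_; _∸_)
open import Data.Vec using (Vec; []; _∷_; replicate; zipWith; map)
open import Data.Product using (Σ; ∃; _×_; _,_)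
open import Data.Sum using (_⊎_)
open import Data.Empty using (⊥)
open import Relation.Nullary using (¬_)
open import Relation.Binary.PropositionalEquality using (_≡_)

-- V(G) = 𝔽₂ⁿ, vectors as bit-vectors of length n
Vector : ℕ → Set
Vector n = Vec Bool n

0v : ∀ {n} → Vector n
0v {n} = replicate n false

_⊕_ : ∀ {n} → Vector n → Vector n → Vector n
_⊕_ = zipWith _xor_

_·_ : ∀ {n} → Bool → Vector n → Vector n
c · v = map (c ∧_) v

lincomb : ∀ {n d} → Vec Bool d → Vec (Vector n) d → Vector n
lincomb [] [] = 0v
lincomb (c ∷ cs) (b ∷ bs) = (c · b) ⊕ lincomb cs bs

LinIndep : ∀ {n d} → Vec (Vector n) d → Set
LinIndep {d = d} bs = ∀ cs → lincomb cs bs ≡ 0v → cs ≡ replicate d false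

InG : ∀ {n} → Vector n → Set
InG x = ¬ (x ≡ 0v)

InSpan : ∀ {n d} → Vec (Vector n) d → Vector n → Set
InSpan bs x = ∃ λ cs → lincomb cs bs ≡ x

-- The flat of G determined by a basis bs (of a d-dimensional subspace):
-- F = span(bs) ∖ {0}; its dimension is d (length of an independent spanning family).
InFlat : ∀ {n d} → Vec (Vector n) d → Vector n → Set
InFlat bs x = InG x × InSpan bs x

record Matroid (n : ℕ) : Set₁ where
  field
    E   : Vector n → Set
    E⊆G : ∀ x → E x → InG x

HasFlatOfDim : ∀ {n} → (Vector n → Set) → ℕ → Set
HasFlatOfDim {n} E d =
  Σ (Vec (Vector n) d) λ bs → LinIndep bs × (∀ x → InFlat bs x → E x)

IsOmega : ∀ {n} → Matroid n → ℕ → Set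
IsOmega M k = HasFlatOfDim (Matroid.E M) k × (∀ d → HasFlatOfDim (Matroid.E M) d → d ≤ k)

complement : ∀ {n} → Matroid n → Matroid n
complement M = record { E = λ x → InG x × ¬ (Matroid.E M x) ; E⊆G = λ x p → Data.Product.proj₁ p }
  where import Data.Product

IsChi : ∀ {n} → Matroid n → ℕ → Set
IsChi {n} M k = ∃ λ w → IsOmega (complement M) w × k ≡ n ∸ w

-- M is a PG-sum: E is the disjoint union of two (possibly empty) flats of G
IsPGSum : ∀ {n} → Matroid n → Set
IsPGSum {n} M =
  Σ ℕ λ d₁ → Σ ℕ λ d₂ → Σ (Vec (Vector n) d₁) λ b₁ → Σ (Vec (Vector n) d₂) λ b₂ →
    LinIndep b₁ × LinIndep b₂ ×
    (∀ x → InFlat b₁ x → InFlat b₂ x → ⊥) ×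
    (∀ x → Matroid.E M x → InFlat b₁ x ⊎ InFlat b₂ x) ×
    (∀ x → InFlat b₁ x ⊎ InFlat b₂ x → Matroid.E M x)

-- Let E = F₁ ⊔ F₂ with dim F₂ ≤ dim F₁ = d.  A flat inside a union of two
-- subspaces lies in one of them, so ω(M) = d.  A flat avoiding E is in
-- direct sum with F₁, so ω(Mᶜ) ≤ n − d; conversely, writing F₁ = ⟨a, r⟩ and
-- F₂ = ⟨b⟩ with |a| = |b|, and completing a, r, b by c to a basis, the flat
-- ⟨c, a + b⟩ of dimension n − d meets neither F₁ nor F₂.
-- Hence χ(M) = n − (n − d) = d = ω(M).
-- Since 𝔽₂ⁿ is finite, membership in a span is decidable, so the classical steps
-- (picking a vector outside a span) are carried out by exhaustive search.
module Submission where

open import Defs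
open import Algebra.Bundles using (CommutativeRing)
import Algebra.Properties.CommutativeSemigroup as CommutativeSemigroupProperties
open import Data.Bool using (Bool; true; false; _xor_; _∧_)
import Data.Bool as Bool
open import Data.Bool.Properties
  using (xor-assoc; xor-identityˡ; xor-identityʳ; xor-same; ∧-distribʳ-xor; xor-∧-commutativeRing)
open import Data.Empty using (⊥; ⊥-elim)
open import Data.Nat using (ℕ; zero; suc; _+_; _≤_; _∸_; z≤n; s≤s)
open import Data.Nat.Properties
  using (≤-trans; n≤1+n; ≤-reflexive; ≤-antisym; ≤-total; <⇒≱; +-comm; ∸-+-assoc;
         m∸n+n≡m; m∸[m∸n]≡n; m+n≤o⇒m≤o∸n; m≤n⇒∃[o]m+o≡n)
open import Data.Product using (Σ; ∃; _×_; _,_; proj₁; proj₂)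
open import Data.Sum using (_⊎_; inj₁; inj₂; [_,_]; [_,_]′; swap)
import Data.Sum as Sum
open import Data.Vec using (Vec; []; _∷_; replicate; zipWith; map; _++_; splitAt)
open import Data.Vec.Properties
  using (≡-dec; ∷-injective; ++-injective; ++-injectiveˡ; zipWith-assoc;
         zipWith-identityˡ; zipWith-identityʳ; map-id; map-const)
open import Data.Vec.Relation.Unary.All using (All; []; _∷_)
import Data.Vec.Relation.Unary.All as All
open import Function using (_∘_; id)
open import Relation.Nullary using (¬_; Dec; yes; no)
open import Relation.Nullary.Decidable using (¬?; _⊎-dec_; map′; decidable-stable)
open import Relation.Binary.PropositionalEquality
  using (_≡_; refl; sym; trans; cong; cong₂; subst; module ≡-Reasoning)
open ≡-Reasoning

private
  variable
    n m d e k : ℕ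
    x y : Vector n

-- Vector space structure of 𝔽₂ⁿ

⊕-assoc : (x y z : Vector n) → (x ⊕ y) ⊕ z ≡ x ⊕ (y ⊕ z)
⊕-assoc = zipWith-assoc xor-assoc

⊕-identityˡ : (x : Vector n) → 0v ⊕ x ≡ x
⊕-identityˡ = zipWith-identityˡ xor-identityˡ

⊕-identityʳ : (x : Vector n) → x ⊕ 0v ≡ x
⊕-identityʳ = zipWith-identityʳ xor-identityʳ

⊕-self : (x : Vector n) → x ⊕ x ≡ 0v
⊕-self [] = refl
⊕-self (a ∷ x) = cong₂ _∷_ (xor-same a) (⊕-self x)

⊕-interchange : (w x y z : Vector n) → (w ⊕ x) ⊕ (y ⊕ z) ≡ (w ⊕ y) ⊕ (x ⊕ z)
⊕-interchange [] [] [] [] = refl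
⊕-interchange (a ∷ w) (b ∷ x) (c ∷ y) (d ∷ z) =
  cong₂ _∷_ (xor-interchange a b c d) (⊕-interchange w x y z)
  where
  open CommutativeSemigroupProperties
    (CommutativeRing.+-commutativeSemigroup xor-∧-commutativeRing)
    renaming (interchange to xor-interchange)

x⊕y⊕y≡x : (x y : Vector n) → (x ⊕ y) ⊕ y ≡ x
x⊕y⊕y≡x x y = trans (⊕-assoc x y y) (trans (cong (x ⊕_) (⊕-self y)) (⊕-identityʳ x))

x⊕[x⊕y]≡y : (x y : Vector n) → x ⊕ (x ⊕ y) ≡ y
x⊕[x⊕y]≡y x y = trans (sym (⊕-assoc x x y)) (trans (cong (_⊕ y) (⊕-self x)) (⊕-identityˡ y))

x⊕y≡0⇒x≡y : (x y : Vector n) → x ⊕ y ≡ 0v → x ≡ y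
x⊕y≡0⇒x≡y x y x⊕y≡0 = begin
  x            ≡⟨ sym (x⊕y⊕y≡x x y) ⟩
  (x ⊕ y) ⊕ y  ≡⟨ cong (_⊕ y) x⊕y≡0 ⟩
  0v ⊕ y       ≡⟨ ⊕-identityˡ y ⟩
  y            ∎

_≟_ : (x y : Vector n) → Dec (x ≡ y)
_≟_ = ≡-dec Bool._≟_

·-identityˡ : (x : Vector n) → true · x ≡ x
·-identityˡ = map-id

·-zeroˡ : (x : Vector n) → false · x ≡ 0v
·-zeroˡ x = map-const x false

·-distribʳ-xor : (a b : Bool) (x : Vector n) → (a xor b) · x ≡ (a · x) ⊕ (b · x)
·-distribʳ-xor a b [] = refl
·-distribʳ-xor a b (c ∷ x) = cong₂ _∷_ (∧-distribʳ-xor c a b) (·-distribʳ-xor a b x)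

·-distribˡ-⊕ : (a : Bool) (x y : Vector n) → a · (x ⊕ y) ≡ (a · x) ⊕ (a · y)
·-distribˡ-⊕ true x y = trans (·-identityˡ _) (sym (cong₂ _⊕_ (·-identityˡ x) (·-identityˡ y)))
·-distribˡ-⊕ false x y =
  trans (·-zeroˡ _) (sym (trans (cong₂ _⊕_ (·-zeroˡ x) (·-zeroˡ y)) (⊕-identityˡ 0v)))

·-assoc : (a b : Bool) (x : Vector n) → a · (b · x) ≡ (a ∧ b) · x
·-assoc true b x = ·-identityˡ _
·-assoc false b x = trans (·-zeroˡ _) (sym (·-zeroˡ x))

replicate-++ : ∀ {A : Set} d e (a : A) → replicate d a ++ replicate e a ≡ replicate (d + e) a
replicate-++ zero e a = refl
replicate-++ (suc d) e a = cong (a ∷_) (replicate-++ d e a)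

lincomb-zeros : (q : Vec (Vector n) d) → lincomb (replicate d false) q ≡ 0v
lincomb-zeros [] = refl
lincomb-zeros (y ∷ q) = trans (cong₂ _⊕_ (·-zeroˡ y) (lincomb-zeros q)) (⊕-identityˡ 0v)

lincomb-false∷ : (y : Vector n) (α : Vec Bool d) (q : Vec (Vector n) d) →
                 lincomb (false ∷ α) (y ∷ q) ≡ lincomb α q
lincomb-false∷ y α q = trans (cong (_⊕ lincomb α q) (·-zeroˡ y)) (⊕-identityˡ _)

lincomb-xor : (α β : Vec Bool d) (q : Vec (Vector n) d) →
              lincomb (zipWith _xor_ α β) q ≡ lincomb α q ⊕ lincomb β q
lincomb-xor [] [] [] = sym (⊕-identityˡ 0v)
lincomb-xor (a ∷ α) (b ∷ β) (y ∷ q) =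
  trans (cong₂ _⊕_ (·-distribʳ-xor a b y) (lincomb-xor α β q)) (⊕-interchange _ _ _ _)

lincomb-⊕ : (α : Vec Bool d) (p q : Vec (Vector n) d) →
            lincomb α (zipWith _⊕_ p q) ≡ lincomb α p ⊕ lincomb α q
lincomb-⊕ [] [] [] = sym (⊕-identityˡ 0v)
lincomb-⊕ (a ∷ α) (x ∷ p) (y ∷ q) =
  trans (cong₂ _⊕_ (·-distribˡ-⊕ a x y) (lincomb-⊕ α p q)) (⊕-interchange _ _ _ _)

lincomb-++ : (α : Vec Bool d) (β : Vec Bool e) (p : Vec (Vector n) d) (q : Vec (Vector n) e) →
             lincomb (α ++ β) (p ++ q) ≡ lincomb α p ⊕ lincomb β q
lincomb-++ [] β [] q = sym (⊕-identityˡ _)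
lincomb-++ (a ∷ α) β (x ∷ p) q =
  trans (cong ((a · x) ⊕_) (lincomb-++ α β p q)) (sym (⊕-assoc _ _ _))

lincomb-++-zerosˡ : (β : Vec Bool e) (p : Vec (Vector n) d) (q : Vec (Vector n) e) →
                    lincomb (replicate d false ++ β) (p ++ q) ≡ lincomb β q
lincomb-++-zerosˡ {d = d} β p q = begin
  lincomb (replicate d false ++ β) (p ++ q) ≡⟨ lincomb-++ (replicate d false) β p q ⟩
  lincomb (replicate d false) p ⊕ lincomb β q ≡⟨ cong (_⊕ lincomb β q) (lincomb-zeros p) ⟩
  0v ⊕ lincomb β q ≡⟨ ⊕-identityˡ _ ⟩
  lincomb β q ∎

lincomb-++-zerosʳ : (α : Vec Bool d) (p : Vec (Vector n) d) (q : Vec (Vector n) e) →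
                    lincomb (α ++ replicate e false) (p ++ q) ≡ lincomb α p
lincomb-++-zerosʳ {e = e} α p q = begin
  lincomb (α ++ replicate e false) (p ++ q) ≡⟨ lincomb-++ α (replicate e false) p q ⟩
  lincomb α p ⊕ lincomb (replicate e false) q ≡⟨ cong (lincomb α p ⊕_) (lincomb-zeros q) ⟩
  lincomb α p ⊕ 0v ≡⟨ ⊕-identityʳ _ ⟩
  lincomb α p ∎

xor≡zeros⇒≡ : (α β : Vec Bool d) → zipWith _xor_ α β ≡ replicate d false → α ≡ β
xor≡zeros⇒≡ [] [] _ = refl
xor≡zeros⇒≡ (a ∷ α) (b ∷ β) eq with ∷-injective eq
xor≡zeros⇒≡ (false ∷ α) (false ∷ β) eq | _ , eq′ = cong (false ∷_) (xor≡zeros⇒≡ α β eq′)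
xor≡zeros⇒≡ (true ∷ α) (true ∷ β) eq | _ , eq′ = cong (true ∷_) (xor≡zeros⇒≡ α β eq′)
xor≡zeros⇒≡ (false ∷ α) (true ∷ β) eq | () , _
xor≡zeros⇒≡ (true ∷ α) (false ∷ β) eq | () , _

lincomb-injective : {q : Vec (Vector n) d} → LinIndep q →
                    {α β : Vec Bool d} → lincomb α q ≡ lincomb β q → α ≡ β
lincomb-injective {q = q} indep {α} {β} eq = xor≡zeros⇒≡ α β (indep _ (begin
  lincomb (zipWith _xor_ α β) q ≡⟨ lincomb-xor α β q ⟩
  lincomb α q ⊕ lincomb β q ≡⟨ cong (_⊕ lincomb β q) eq ⟩
  lincomb β q ⊕ lincomb β q ≡⟨ ⊕-self _ ⟩
  0v ∎))

∃? : ∀ d {P : Vec Bool d → Set} → (∀ v → Dec (P v)) → Dec (∃ P)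
∃? zero P? = map′ ([] ,_) (λ { ([] , p) → p }) (P? [])
∃? (suc d) {P} P? = map′ [ (λ (v , p) → true ∷ v , p) , (λ (v , p) → false ∷ v , p) ]′ split
                         (∃? d (P? ∘ (true ∷_)) ⊎-dec ∃? d (P? ∘ (false ∷_)))
  where
  split : ∃ P → ∃ (P ∘ (true ∷_)) ⊎ ∃ (P ∘ (false ∷_))
  split (true ∷ v , p) = inj₁ (v , p)
  split (false ∷ v , p) = inj₂ (v , p)

InSpan? : (q : Vec (Vector n) d) (x : Vector n) → Dec (InSpan q x)
InSpan? {d = d} q x = ∃? d (λ cs → lincomb cs q ≟ x)

InSpan-0v : (q : Vec (Vector n) d) → InSpan q 0v
InSpan-0v q = replicate _ false , lincomb-zeros q

InSpan-⊕ : {q : Vec (Vector n) d} → InSpan q x → InSpan q y → InSpan q (x ⊕ y)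
InSpan-⊕ {q = q} (α , refl) (β , refl) = zipWith _xor_ α β , lincomb-xor α β q

InSpan-· : {q : Vec (Vector n) d} (c : Bool) → InSpan q x → InSpan q (c · x)
InSpan-· {x = x} true x∈ = subst (InSpan _) (sym (·-identityˡ x)) x∈
InSpan-· {x = x} {q = q} false _ = subst (InSpan q) (sym (·-zeroˡ x)) (InSpan-0v q)

InSpan-∷ : {q : Vec (Vector n) d} (y : Vector n) → InSpan q x → InSpan (y ∷ q) x
InSpan-∷ {q = q} y (α , refl) = false ∷ α , lincomb-false∷ y α q

InSpan-self : (q : Vec (Vector n) d) → All (InSpan q) q
InSpan-self [] = []
InSpan-self (y ∷ q) =
  (true ∷ replicate _ false , trans (cong₂ _⊕_ (·-identityˡ y) (lincomb-zeros q)) (⊕-identityʳ y))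
  ∷ All.map (InSpan-∷ y) (InSpan-self q)

InSpan-trans : {r : Vec (Vector n) e} (q : Vec (Vector n) d) → All (InSpan r) q →
               InSpan q x → InSpan r x
InSpan-trans [] [] ([] , refl) = InSpan-0v _
InSpan-trans (y ∷ q) (y∈ ∷ q⊆) (c ∷ cs , refl) =
  InSpan-⊕ (InSpan-· c y∈) (InSpan-trans q q⊆ (cs , refl))

LinIndep-head≢0 : {q : Vec (Vector n) d} → LinIndep (x ∷ q) → InG x
LinIndep-head≢0 {x = x} {q = q} indep x≡0
  with () ← indep (true ∷ replicate _ false)
                  (trans (cong₂ _⊕_ (trans (·-identityˡ x) x≡0) (lincomb-zeros q)) (⊕-identityˡ 0v))

LinIndep-∷ : {q : Vec (Vector n) d} → LinIndep q → ¬ InSpan q x → LinIndep (x ∷ q)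
LinIndep-∷ {x = x} {q = q} indep x∉ (true ∷ cs) eq =
  ⊥-elim (x∉ (cs , sym (x⊕y≡0⇒x≡y x _ (trans (cong (_⊕ _) (sym (·-identityˡ x))) eq))))
LinIndep-∷ {x = x} {q = q} indep x∉ (false ∷ cs) eq =
  cong (false ∷_) (indep cs (trans (sym (lincomb-false∷ x cs q)) eq))

LinIndep-++ : (p : Vec (Vector n) d) (q : Vec (Vector n) e) → LinIndep p → LinIndep q →
              (∀ x → InFlat p x → InFlat q x → ⊥) → LinIndep (p ++ q)
LinIndep-++ {d = d} {e = e} p q indep-p indep-q disjoint cs sum≡0 with splitAt d cs
... | α , β , refl = from-equal (x⊕y≡0⇒x≡y _ _ (trans (sym (lincomb-++ α β p q)) sum≡0))
  where
  from-equal : lincomb α p ≡ lincomb β q → α ++ β ≡ replicate (d + e) false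
  from-equal same with lincomb α p ≟ 0v
  ... | yes α≡0 = trans (cong₂ _++_ (indep-p α α≡0) (indep-q β (trans (sym same) α≡0)))
                        (replicate-++ d e false)
  ... | no α≢0 = ⊥-elim (disjoint _ (α≢0 , α , refl) (α≢0 , β , sym same))

-- The Steinitz exchange lemma

exchange : (q : Vec (Vector n) (suc k)) → InG x → InSpan q x →
           Σ (Vec (Vector n) k) λ s → All (InSpan (x ∷ s)) q
exchange {x = x} (y ∷ q) _ (true ∷ α , y+L≡x) = q , y∈ ∷ All.tail (InSpan-self (x ∷ q))
  where
  y∈ : InSpan (x ∷ q) y
  y∈ = true ∷ α , (begin
    (true · x) ⊕ lincomb α q
      ≡⟨ cong (_⊕ lincomb α q) (trans (·-identityˡ x) (sym y+L≡x)) ⟩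
    ((true · y) ⊕ lincomb α q) ⊕ lincomb α q ≡⟨ x⊕y⊕y≡x _ _ ⟩
    true · y                                 ≡⟨ ·-identityˡ y ⟩
    y                                        ∎)
exchange (y ∷ []) x≢0 (false ∷ [] , eq) = ⊥-elim (x≢0 (trans (sym eq) (lincomb-false∷ y [] [])))
exchange {x = x} (y ∷ z ∷ q) x≢0 (false ∷ α , eq)
  with s , z∷q⊆ ← exchange (z ∷ q) x≢0 (α , trans (sym (lincomb-false∷ y α (z ∷ q))) eq) =
  y ∷ s , y∈ ∷ All.map (InSpan-trans (x ∷ s) x∷s⊆) z∷q⊆
  where
  self : All (InSpan (x ∷ y ∷ s)) (x ∷ y ∷ s)
  self = InSpan-self (x ∷ y ∷ s)
  y∈ : InSpan (x ∷ y ∷ s) y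
  y∈ = All.head (All.tail self)
  x∷s⊆ : All (InSpan (x ∷ y ∷ s)) (x ∷ s)
  x∷s⊆ = All.head self ∷ All.tail (All.tail self)

project : (x : Vector n) (s : Vec (Vector n) k) (p : Vec (Vector n) m) → All (InSpan (x ∷ s)) p →
          Σ (Vec (Vector n) m) λ p′ → All (InSpan s) p′ ×
            (∀ cs → ∃ λ a → lincomb cs p ≡ (a · x) ⊕ lincomb cs p′)
project x s [] [] = [] , [] , λ { [] → false , sym (trans (⊕-identityʳ _) (·-zeroˡ x)) }
project x s (y ∷ p) ((b ∷ δ , refl) ∷ p⊆)
  with p′ , p′⊆ , p≈p′ ← project x s p p⊆ =
  lincomb δ s ∷ p′ , (δ , refl) ∷ p′⊆ , decompose
  where
  decompose : ∀ cs → ∃ λ a →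
              lincomb cs ((b · x) ⊕ lincomb δ s ∷ p) ≡ (a · x) ⊕ lincomb cs (lincomb δ s ∷ p′)
  decompose (c ∷ cs) with a , eq ← p≈p′ cs = (c ∧ b) xor a , (begin
    (c · ((b · x) ⊕ y′)) ⊕ lincomb cs p
      ≡⟨ cong₂ _⊕_ (·-distribˡ-⊕ c _ _) eq ⟩
    ((c · (b · x)) ⊕ (c · y′)) ⊕ ((a · x) ⊕ L′)
      ≡⟨ cong (λ v → (v ⊕ (c · y′)) ⊕ ((a · x) ⊕ L′)) (·-assoc c b x) ⟩
    (((c ∧ b) · x) ⊕ (c · y′)) ⊕ ((a · x) ⊕ L′)
      ≡⟨ ⊕-interchange _ _ _ _ ⟩
    (((c ∧ b) · x) ⊕ (a · x)) ⊕ ((c · y′) ⊕ L′)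
      ≡⟨ cong (_⊕ ((c · y′) ⊕ L′)) (sym (·-distribʳ-xor (c ∧ b) a x)) ⟩
    (((c ∧ b) xor a) · x) ⊕ ((c · y′) ⊕ L′) ∎)
    where
    y′ L′ : Vector _
    y′ = lincomb δ s
    L′ = lincomb cs p′

steinitz : (p : Vec (Vector n) m) (q : Vec (Vector n) k) → LinIndep p → All (InSpan q) p → m ≤ k
steinitz [] q _ _ = z≤n
steinitz (x ∷ p) [] indep (([] , 0≡x) ∷ _) = ⊥-elim (LinIndep-head≢0 indep (sym 0≡x))
steinitz (x ∷ p) (y ∷ q) indep (x∈ ∷ p⊆)
  with s , y∷q⊆ ← exchange (y ∷ q) (LinIndep-head≢0 indep) x∈
  with p′ , p′⊆ , p≈p′ ← project x s p (All.map (InSpan-trans (y ∷ q) y∷q⊆) p⊆) =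
  s≤s (steinitz p′ s indep′ p′⊆)
  where
  indep′ : LinIndep p′
  indep′ cs L′≡0 with a , eq ← p≈p′ cs = proj₂ (∷-injective (indep (a ∷ cs) (begin
    (a · x) ⊕ lincomb cs p              ≡⟨ cong ((a · x) ⊕_) eq ⟩
    (a · x) ⊕ ((a · x) ⊕ lincomb cs p′) ≡⟨ x⊕[x⊕y]≡y _ _ ⟩
    lincomb cs p′                       ≡⟨ L′≡0 ⟩
    0v                                  ∎)))

standardBasis : ∀ n → Vec (Vector n) n
standardBasis zero = []
standardBasis (suc n) = (true ∷ 0v) ∷ map (false ∷_) (standardBasis n)

lincomb-map-false∷ : (cs : Vec Bool d) (vs : Vec (Vector n) d) →
                     lincomb cs (map (false ∷_) vs) ≡ false ∷ lincomb cs vs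
lincomb-map-false∷ [] [] = refl
lincomb-map-false∷ (true ∷ cs) (v ∷ vs) = cong (_ ⊕_) (lincomb-map-false∷ cs vs)
lincomb-map-false∷ (false ∷ cs) (v ∷ vs) = cong (_ ⊕_) (lincomb-map-false∷ cs vs)

lincomb-standardBasis : ∀ n (cs : Vector n) → lincomb cs (standardBasis n) ≡ cs
lincomb-standardBasis zero [] = refl
lincomb-standardBasis (suc n) (c ∷ cs) = begin
  (c · (true ∷ 0v)) ⊕ lincomb cs (map (false ∷_) (standardBasis n))
    ≡⟨ cong ((c · (true ∷ 0v)) ⊕_) (lincomb-map-false∷ cs (standardBasis n)) ⟩
  (c · (true ∷ 0v)) ⊕ (false ∷ lincomb cs (standardBasis n))
    ≡⟨ cong (λ v → (c · (true ∷ 0v)) ⊕ (false ∷ v)) (lincomb-standardBasis n cs) ⟩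
  (c · (true ∷ 0v)) ⊕ (false ∷ cs)
    ≡⟨ head-and-tail c ⟩
  c ∷ cs ∎
  where
  head-and-tail : ∀ c → (c · (true ∷ 0v)) ⊕ (false ∷ cs) ≡ c ∷ cs
  head-and-tail true = cong (true ∷_) (trans (cong (_⊕ cs) (·-identityˡ 0v)) (⊕-identityˡ cs))
  head-and-tail false = cong (false ∷_) (trans (cong (_⊕ cs) (·-zeroˡ 0v)) (⊕-identityˡ cs))

standardBasis-independent : ∀ n → LinIndep (standardBasis n)
standardBasis-independent n cs eq = trans (sym (lincomb-standardBasis n cs)) eq

length≤dim : (p : Vec (Vector n) m) → LinIndep p → m ≤ n
length≤dim {n = n} p indep =
  steinitz p (standardBasis n) indep (All.universal (λ x → x , lincomb-standardBasis n x) p)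

extend : ∀ k {p : Vec (Vector n) d} → LinIndep p → k + d ≤ n →
         Σ (Vec (Vector n) k) λ c → LinIndep (c ++ p)
extend zero indep _ = [] , indep
extend {n = n} {d = d} (suc k) {p} indep k+d<n
  with c , indep′ ← extend k indep (≤-trans (n≤1+n _) k+d<n)
  with ∃? n (λ x → ¬? (InSpan? (c ++ p) x))
... | yes (x , x∉) = x ∷ c , LinIndep-∷ indep′ x∉
... | no none = ⊥-elim (<⇒≱ k+d<n n≤k+d)
  where
  spanned : ∀ x → InSpan (c ++ p) x
  spanned x = decidable-stable (InSpan? (c ++ p) x) (λ x∉ → none (x , x∉))
  n≤k+d : n ≤ k + d
  n≤k+d = steinitz (standardBasis n) (c ++ p) (standardBasis-independent n)
                   (All.universal spanned (standardBasis n))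

-- Flats

HasFlatOfDim-mono : {P Q : Vector n → Set} → (∀ {x} → InG x → P x → Q x) →
                    HasFlatOfDim P d → HasFlatOfDim Q d
HasFlatOfDim-mono P⇒Q (w , indep , w⊆P) = w , indep , λ x x∈ → P⇒Q (proj₁ x∈) (w⊆P x x∈)

flat⊆span⇒All : {b : Vec (Vector n) e} (w : Vec (Vector n) d) →
                (∀ x → InFlat w x → InSpan b x) → All (InSpan b) w
flat⊆span⇒All {b = b} w w⊆b = All.map into (InSpan-self w)
  where
  into : InSpan w x → InSpan b x
  into {x = x} x∈ with x ≟ 0v
  ... | yes refl = InSpan-0v b
  ... | no x≢0 = w⊆b x (x≢0 , x∈)

-- If v ∈ ⟨w⟩ ∖ ⟨b₁⟩ and y ∈ ⟨w⟩ ∖ ⟨b₂⟩, then v + y ∈ ⟨w⟩ lies in neither ⟨b₁⟩ nor ⟨b₂⟩.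
flat⊆∪⇒flat⊆ : {b₁ : Vec (Vector n) d} {b₂ : Vec (Vector n) e} (w : Vec (Vector n) k) →
               (∀ x → InFlat w x → InSpan b₁ x ⊎ InSpan b₂ x) →
               (∀ x → InFlat w x → InSpan b₁ x) ⊎ (∀ x → InFlat w x → InSpan b₂ x)
flat⊆∪⇒flat⊆ {k = k} {b₁ = b₁} {b₂} w cover
  with ∃? k (λ cs → ¬? (InSpan? b₁ (lincomb cs w)))
... | no none =
  inj₁ λ { x (_ , cs , refl) → decidable-stable (InSpan? b₁ _) (λ x∉ → none (cs , x∉)) }
... | yes (cs , v∉₁) = inj₂ in-b₂
  where
  v : Vector _
  v = lincomb cs w
  v≢0 : InG v
  v≢0 v≡0 = v∉₁ (subst (InSpan b₁) (sym v≡0) (InSpan-0v b₁))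
  v∈₂ : InSpan b₂ v
  v∈₂ = [ ⊥-elim ∘ v∉₁ , id ]′ (cover v (v≢0 , cs , refl))
  in-b₂ : ∀ y → InFlat w y → InSpan b₂ y
  in-b₂ y (y≢0 , y∈w) with InSpan? b₂ y
  ... | yes y∈₂ = y∈₂
  ... | no y∉₂ = ⊥-elim ([ (λ z∈₁ → v∉₁ (subst (InSpan b₁) (x⊕y⊕y≡x v y) (InSpan-⊕ z∈₁ y∈₁)))
                          , (λ z∈₂ → y∉₂ (subst (InSpan b₂) (x⊕[x⊕y]≡y v y) (InSpan-⊕ v∈₂ z∈₂))) ]
                          (cover (v ⊕ y) (v⊕y≢0 , InSpan-⊕ (cs , refl) y∈w)))
    where
    y∈₁ : InSpan b₁ y
    y∈₁ = [ id , ⊥-elim ∘ y∉₂ ]′ (cover y (y≢0 , y∈w))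
    v⊕y≢0 : InG (v ⊕ y)
    v⊕y≢0 v⊕y≡0 = v∉₁ (subst (InSpan b₁) (sym (x⊕y≡0⇒x≡y v y v⊕y≡0)) y∈₁)

-- Relative to the basis c, a, r, b, the vector Σ γᵢcᵢ + Σ αᵢ(aᵢ + bᵢ) has coordinates
-- (γ, α, 0, α); vectors of ⟨a, r⟩ have coordinates (0, β₁, β₂, 0) and those of ⟨b⟩ have
-- (0, 0, 0, δ), so a common vector needs γ = α = 0.
module ComplementaryFlat {n m d k : ℕ}
  (c : Vec (Vector n) m) (a : Vec (Vector n) d) (r : Vec (Vector n) k) (b : Vec (Vector n) d)
  (indep : LinIndep (c ++ ((a ++ r) ++ b))) where

  u : Vec (Vector n) (m + d)
  u = c ++ zipWith _⊕_ a b

  basis : Vec (Vector n) (m + ((d + k) + d))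
  basis = c ++ ((a ++ r) ++ b)

  lincomb-u : ∀ γ α → lincomb (γ ++ α) u ≡ lincomb (γ ++ ((α ++ replicate k false) ++ α)) basis
  lincomb-u γ α = begin
    lincomb (γ ++ α) u
      ≡⟨ lincomb-++ γ α c _ ⟩
    lincomb γ c ⊕ lincomb α (zipWith _⊕_ a b)
      ≡⟨ cong (lincomb γ c ⊕_) (lincomb-⊕ α a b) ⟩
    lincomb γ c ⊕ (lincomb α a ⊕ lincomb α b)
      ≡⟨ cong (λ v → lincomb γ c ⊕ (v ⊕ lincomb α b)) (sym (lincomb-++-zerosʳ α a r)) ⟩
    lincomb γ c ⊕ (lincomb (α ++ replicate k false) (a ++ r) ⊕ lincomb α b)
      ≡⟨ cong (lincomb γ c ⊕_) (sym (lincomb-++ (α ++ replicate k false) α (a ++ r) b)) ⟩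
    lincomb γ c ⊕ lincomb ((α ++ replicate k false) ++ α) ((a ++ r) ++ b)
      ≡⟨ sym (lincomb-++ γ _ c _) ⟩
    lincomb (γ ++ ((α ++ replicate k false) ++ α)) basis ∎

  coordinates : ∀ γ α γ′ β δ → lincomb (γ ++ α) u ≡ lincomb (γ′ ++ (β ++ δ)) basis →
                γ ≡ γ′ × α ++ replicate k false ≡ β × α ≡ δ
  coordinates γ α γ′ β δ eq
    with γ≡γ′ , rest ← ++-injective γ γ′ (lincomb-injective indep (trans (sym (lincomb-u γ α)) eq))
    =
    γ≡γ′ , ++-injective (α ++ replicate k false) β rest

  in-⟨a,r⟩⇒zero : ∀ γ α β → lincomb (γ ++ α) u ≡ lincomb β (a ++ r) →
                  γ ≡ replicate m false × α ≡ replicate d false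
  in-⟨a,r⟩⇒zero γ α β eq
    with γ≡0 , _ , α≡0 ← coordinates γ α _ β _ (trans eq (sym (begin
      lincomb (replicate m false ++ (β ++ replicate d false)) basis ≡⟨ lincomb-++-zerosˡ _ c _ ⟩
      lincomb (β ++ replicate d false) ((a ++ r) ++ b)           ≡⟨ lincomb-++-zerosʳ β _ b ⟩
      lincomb β (a ++ r)                                         ∎))) =
    γ≡0 , α≡0

  in-⟨b⟩⇒zero : ∀ γ α δ → lincomb (γ ++ α) u ≡ lincomb δ b →
                γ ≡ replicate m false × α ≡ replicate d false
  in-⟨b⟩⇒zero γ α δ eq
    with γ≡0 , α0≡0 , _ ← coordinates γ α _ (replicate (d + k) false) δ (trans eq (sym (begin
      lincomb (replicate m false ++ (replicate (d + k) false ++ δ)) basis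
        ≡⟨ lincomb-++-zerosˡ _ c _ ⟩
      lincomb (replicate (d + k) false ++ δ) ((a ++ r) ++ b)
        ≡⟨ lincomb-++-zerosˡ δ (a ++ r) b ⟩
      lincomb δ b ∎))) =
    γ≡0 , ++-injectiveˡ α (replicate d false) (trans α0≡0 (sym (replicate-++ d k false)))

  u-independent : LinIndep u
  u-independent cs eq with splitAt m cs
  ... | γ , α , refl
    with refl , refl ← in-⟨b⟩⇒zero γ α (replicate d false) (trans eq (sym (lincomb-zeros b))) =
    replicate-++ m d false

  u-avoids : ∀ x → InFlat u x → ¬ InSpan (a ++ r) x × ¬ InSpan b x
  u-avoids x (x≢0 , cs , refl) with splitAt m cs
  ... | γ , α , refl = (λ (β , eq) → vanish (in-⟨a,r⟩⇒zero γ α β (sym eq)))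
                     , (λ (δ , eq) → vanish (in-⟨b⟩⇒zero γ α δ (sym eq)))
    where
    vanish : γ ≡ replicate m false × α ≡ replicate d false → ⊥
    vanish (refl , refl) =
      x≢0 (trans (lincomb-++-zerosˡ _ c _) (lincomb-zeros (zipWith _⊕_ a b)))

avoiding-flat : (bA : Vec (Vector n) d) (bB : Vec (Vector n) e) → e ≤ d → LinIndep (bA ++ bB) →
                HasFlatOfDim (λ x → ¬ InSpan bA x × ¬ InSpan bB x) (n ∸ d)
avoiding-flat {n = n} {e = e} bA bB e≤d indep
  with k , refl ← m≤n⇒∃[o]m+o≡n e≤d with splitAt e bA
... | a , r , refl = subst (HasFlatOfDim _) dim-u (u , u-independent , u-avoids)
  where
  total≤n : (e + k) + e ≤ n
  total≤n = length≤dim _ indep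
  l : ℕ
  l = n ∸ ((e + k) + e)
  completion : Σ (Vec (Vector n) l) λ c → LinIndep (c ++ ((a ++ r) ++ bB))
  completion = extend l indep (≤-reflexive (m∸n+n≡m total≤n))
  open ComplementaryFlat (proj₁ completion) a r bB (proj₂ completion)
  dim-u : l + e ≡ n ∸ (e + k)
  dim-u = begin
    n ∸ ((e + k) + e) + e
      ≡⟨ cong (_+ e) (sym (∸-+-assoc n (e + k) e)) ⟩
    n ∸ (e + k) ∸ e + e
      ≡⟨ m∸n+n≡m (m+n≤o⇒m≤o∸n e (subst (_≤ n) (+-comm (e + k) e) total≤n)) ⟩
    n ∸ (e + k) ∎

IsOmega-≡ : {M : Matroid n} {w : ℕ} → HasFlatOfDim (Matroid.E M) d →
            (∀ d′ → HasFlatOfDim (Matroid.E M) d′ → d′ ≤ d) → IsOmega M w → w ≡ d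
IsOmega-≡ flat maximal (flat-w , maximal-w) = ≤-antisym (maximal _ flat-w) (maximal-w _ flat)

module PGSum {n dA dB : ℕ} (M : Matroid n) (bA : Vec (Vector n) dA) (bB : Vec (Vector n) dB)
  (indepA : LinIndep bA) (indepB : LinIndep bB)
  (disjoint : ∀ x → InFlat bA x → InFlat bB x → ⊥)
  (E⊆A∪B : ∀ x → Matroid.E M x → InFlat bA x ⊎ InFlat bB x)
  (A∪B⊆E : ∀ x → InFlat bA x ⊎ InFlat bB x → Matroid.E M x)
  (dB≤dA : dB ≤ dA) where

  open Matroid M using (E)

  flat⊆E⇒dim≤dA : ∀ d → HasFlatOfDim E d → d ≤ dA
  flat⊆E⇒dim≤dA d (w , indep , w⊆E)
    with flat⊆∪⇒flat⊆ w (λ x x∈ → Sum.map proj₂ proj₂ (E⊆A∪B x (w⊆E x x∈)))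
  ... | inj₁ w⊆A = steinitz w bA indep (flat⊆span⇒All w w⊆A)
  ... | inj₂ w⊆B = ≤-trans (steinitz w bB indep (flat⊆span⇒All w w⊆B)) dB≤dA

  ω≡dA : ∀ {b} → IsOmega M b → b ≡ dA
  ω≡dA = IsOmega-≡ {M = M} (bA , indepA , λ x x∈ → A∪B⊆E x (inj₁ x∈)) flat⊆E⇒dim≤dA

  flat⊆Eᶜ⇒dim≤n∸dA : ∀ d → HasFlatOfDim (Matroid.E (complement M)) d → d ≤ n ∸ dA
  flat⊆Eᶜ⇒dim≤n∸dA d (u , indep , u⊆Eᶜ) =
    m+n≤o⇒m≤o∸n d (length≤dim (u ++ bA)
      (LinIndep-++ u bA indep indepA λ x x∈u x∈A → proj₂ (u⊆Eᶜ x x∈u) (A∪B⊆E x (inj₁ x∈A))))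

  flat⊆Eᶜ : HasFlatOfDim (Matroid.E (complement M)) (n ∸ dA)
  flat⊆Eᶜ = HasFlatOfDim-mono outside-E
    (avoiding-flat bA bB dB≤dA (LinIndep-++ bA bB indepA indepB disjoint))
    where
    outside-E : InG x → ¬ InSpan bA x × ¬ InSpan bB x → InG x × ¬ E x
    outside-E {x = x} x≢0 (x∉A , x∉B) = x≢0 , [ x∉A ∘ proj₂ , x∉B ∘ proj₂ ] ∘ E⊆A∪B x

  χ≡dA : ∀ {a} → IsChi M a → a ≡ dA
  χ≡dA {a} (w , ωᶜ , a≡n∸w) = begin
    a            ≡⟨ a≡n∸w ⟩
    n ∸ w        ≡⟨ cong (n ∸_) ωᶜ≡n∸dA ⟩
    n ∸ (n ∸ dA) ≡⟨ m∸[m∸n]≡n (length≤dim bA indepA) ⟩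
    dA           ∎
    where
    ωᶜ≡n∸dA : w ≡ n ∸ dA
    ωᶜ≡n∸dA = IsOmega-≡ {M = complement M} flat⊆Eᶜ flat⊆Eᶜ⇒dim≤n∸dA ωᶜ

lemma2p9 : (n : ℕ) (M : Matroid n) → IsPGSum M →
    (a b : ℕ) → IsChi M a → IsOmega M b → a ≡ b
lemma2p9 n M (d₁ , d₂ , b₁ , b₂ , indep₁ , indep₂ , disjoint , E⊆₁∪₂ , ₁∪₂⊆E) a b χ ω
  with ≤-total d₂ d₁
... | inj₁ d₂≤d₁ = trans (χ≡dA χ) (sym (ω≡dA ω))
  where open PGSum M b₁ b₂ indep₁ indep₂ disjoint E⊆₁∪₂ ₁∪₂⊆E d₂≤d₁
... | inj₂ d₁≤d₂ = trans (χ≡dA χ) (sym (ω≡dA ω))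
  where open PGSum M b₂ b₁ indep₂ indep₁ (λ x x∈₂ x∈₁ → disjoint x x∈₁ x∈₂)
                   (λ x → swap ∘ E⊆₁∪₂ x) (λ x → ₁∪₂⊆E x ∘ swap) d₁≤d₂
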